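{- Let $G$ be a finite DAG with leaf set $X$ that has the $k$-$\mathrm{lca}$-property ($k\ge1$). Define $R_G:X^{(k)}\to 2^X$ by $R_G(U)=\mathrm{C}(\mathrm{lca}(U))$. Then $R_G$ is a monotone $k$-ary transit function with $R_G=R_{\mathscr{C}_G}$. Moreover, $\mathscr{C}_G$ is pre-$k$-ary.
   Context: For a finite DAG $G$, write $v\preceq w$ if there is a directed path (possibly of length $0$) from $w$ to $v$; the leaf set $X$ is the set of $\preceq$-minimal vertices; $\mathrm{C}(v)=\{x\in X\mid x\preceq v\}$ and $\mathscr{C}_G=\{\mathrm{C}(v)\mid v\in V(G)\}$. $X^{(k)}$ is the set of non-empty subsets of $X$ of size at most $k$. A least common ancestor of $Y\subseteq V(G)$ is a $\preceq$-minimal element of the set of common ancestors of all elements of $Y$; $\mathrm{lca}(Y)$ is defined (and equals $q$) if $q$ is the only such vertex. $G$ has the $k$-$\mathrm{lca}$-property if $\mathrm{lca}(A)$ is defined for all $A\in X^{(k)}$. A $k$-ary transit function on $X$ is a map $R:X^{(k)}\to 2^X$ with $U\subseteq R(U)$ for all $U$ and $R(\{x\})=\{x\}$ for all $x\in X$; it is monotone if $W\subseteq R(U)$ implies $R(W)\subseteq R(U)$ for all $U,W\in X^{(k)}$. For a set system $\mathscr{C}$ on $X$, $R_{\mathscr{C}}(U)=\bigcap\{C\in\mathscr{C}\mid U\subseteq C\}$ for $U\in X^{(k)}$. $\mathscr{C}$ is pre-$k$-ary if $R_{\mathscr{C}}(U)\in\mathscr{C}$ for all $U\in X^{(k)}$.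 -}

module Defs where

open import Level using (0ℓ)
open import Data.Nat using (ℕ; _≤_)
open import Data.Fin using (Fin)
open import Data.Fin.Subset using (Subset; _∈_; ∣_∣; Nonempty)
open import Data.Product using (Σ; _×_; proj₁)
open import Data.Empty using (⊥)
open import Relation.Binary using (Rel; Decidable)
open import Relation.Binary.PropositionalEquality using (_≡_)
open import Relation.Binary.Construct.Closure.ReflexiveTransitive using (Star)
open import Relation.Unary using (Pred)

record DAG : Set₁ where
  field
    n       : ℕ
    E       : Rel (Fin n) 0ℓ
    E?      : Decidable E
    acyclic : ∀ {u v} → E u v → Star E v u → ⊥

module _ (G : DAG) where
  open DAG G

  V : Set
  V = Fin n

  _⪯_ : V → V → Set
  v ⪯ w = Star E w v

  IsLeaf : V → Set
  IsLeaf x = ∀ v → v ⪯ x → v ≡ x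

  C : V → Pred V 0ℓ
  C v x = IsLeaf x × (x ⪯ v)

  InXk : ℕ → Subset n → Set
  InXk k U = (∀ x → x ∈ U → IsLeaf x) × Nonempty U × (∣ U ∣ ≤ k)

  CommonAnc : Subset n → V → Set
  CommonAnc U q = ∀ u → u ∈ U → u ⪯ q

  IsLCA : Subset n → V → Set
  IsLCA U q = CommonAnc U q × (∀ q' → CommonAnc U q' → q' ⪯ q → q' ≡ q)

  LcaIs : Subset n → V → Set
  LcaIs U q = IsLCA U q × (∀ q' → IsLCA U q' → q' ≡ q)

  KLcaProperty : ℕ → Set
  KLcaProperty k = ∀ A → InXk k A → Σ V (LcaIs A)

  R-G : (k : ℕ) → KLcaProperty k → (U : Subset n) → InXk k U → Pred V 0ℓ
  R-G k P U hU = C (proj₁ (P U hU))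

  _≐_ : Pred V 0ℓ → Pred V 0ℓ → Set
  A ≐ B = (∀ x → A x → B x) × (∀ x → B x → A x)

  KaryMap : ℕ → Set₁
  KaryMap k = (U : Subset n) → InXk k U → Pred V 0ℓ

  IsTransitFunction : (k : ℕ) → KaryMap k → Set
  IsTransitFunction k R =
    (∀ U hU x → R U hU x → IsLeaf x) ×
    (∀ U hU x → x ∈ U → R U hU x) ×
    (∀ x (h : InXk k (Data.Fin.Subset.⁅_⁆ x)) → R (Data.Fin.Subset.⁅_⁆ x) h ≐ (_≡ x))

  IsMonotone : (k : ℕ) → KaryMap k → Set
  IsMonotone k R = ∀ U hU W hW → (∀ x → x ∈ W → R U hU x) → ∀ y → R W hW y → R U hU y

  -- the set system 𝒞_G = { C(v) | v ∈ V(G) } (given as the family C indexed by vertices)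
  -- R_𝒞(U) = ⋂ { C ∈ 𝒞_G | U ⊆ C }   (intersection taken inside X)
  R-𝒞 : Subset n → Pred V 0ℓ
  R-𝒞 U x = IsLeaf x × (∀ v → (∀ u → u ∈ U → C v u) → C v x)

  PreKary : ℕ → Set
  PreKary k = ∀ U → InXk k U → Σ V (λ v → R-𝒞 U ≐ C v)

-- The lca of U lies below every common ancestor c of U: since strict descent in a finite DAG
-- is well-founded (a path visits distinct vertices, so it has fewer arcs than there are
-- vertices) and "is a common ancestor of U" is decidable, below c there is a ⪯-minimal common
-- ancestor, i.e. a least common ancestor, and that is lca(U) by uniqueness. Hence C(lca U) is
-- contained in every cluster C(v) ⊇ U while itself containing U, so it is the intersection
-- R_𝒞(U); monotonicity follows because W ⊆ C(lca U) makes lca U a common ancestor of W.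
module Submission where

open import Defs renaming (_⪯_ to infix 4 _⊢_⪯_)
open import Level using (Level; 0ℓ; _⊔_)
open import Data.Nat using (ℕ; zero; suc; _≥_; s≤s) renaming (_<_ to _<ℕ_)
open import Data.Nat.Properties using (≤-pred; n≮0)
open import Data.Product using (Σ; _×_; _,_; proj₁; proj₂; swap)
open import Data.Fin using (Fin; zero; suc; _<_; _≟_)
open import Data.Fin.Properties using (any?; all?; injective⇒≤; <-cmp)
open import Data.Fin.Subset using (_∈_; ⁅_⁆)
open import Data.Fin.Subset.Properties using (_∈?_; x∈⁅x⁆; x∈⁅y⁆⇔x≡y)
open import Data.Empty using (⊥; ⊥-elim)
open import Function using (flip)
open import Function.Bundles using (Equivalence)
open import Function.Definitions using (Injective)
open import Induction.WellFounded using (Acc; acc; WellFounded)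
open import Relation.Binary using (Rel; Decidable; tri<; tri≈; tri>)
open import Relation.Binary.Construct.Closure.ReflexiveTransitive using (Star; ε; _◅_; _◅◅_)
open import Relation.Binary.Construct.Closure.Transitive as Plus using (TransClosure; [_]; _∷ʳ_)
open import Relation.Binary.PropositionalEquality using (_≡_; refl; sym; subst)
open import Relation.Nullary using (Dec; yes; no)
open import Relation.Nullary.Decidable using (map′; _×-dec_; _→-dec_; ¬?; decidable-stable)
open import Relation.Unary using (Pred)
import Relation.Unary as U

module _ {a ℓ : Level} {A : Set a} {R : Rel A ℓ} where

  length : ∀ {x y} → Star R x y → ℕ
  length ε       = 0
  length (_ ◅ p) = suc (length p)

  vertexAt : ∀ {x y} (p : Star R x y) → Fin (suc (length p)) → A
  vertexAt {x} p       zero    = x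
  vertexAt     (_ ◅ p) (suc i) = vertexAt p i

  prefix : ∀ {x y} (p : Star R x y) i → Star R x (vertexAt p i)
  prefix p       zero    = ε
  prefix (r ◅ p) (suc i) = r ◅ prefix p i

  arc-between : ∀ {x y} (p : Star R x y) {i j} → i < j →
                Σ A λ u → R (vertexAt p i) u × Star R u (vertexAt p j)
  arc-between (r ◅ p) {zero}  {suc j} _         = _ , r , prefix p j
  arc-between (r ◅ p) {suc i} {suc j} (s≤s i<j) = arc-between p i<j

  Minimal : ∀ {p} → Pred A p → Pred A (a ⊔ ℓ ⊔ p)
  Minimal P m = P m × (∀ q → P q → Star R m q → q ≡ m)

  arc-star-⁺ : ∀ {c u q} → R c u → Star R u q → TransClosure (flip R) q c
  arc-star-⁺ r ε        = [ r ]
  arc-star-⁺ r (r′ ◅ p) = arc-star-⁺ r′ p ∷ʳ r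

module _ {n : ℕ} {E : Rel (Fin n) 0ℓ} (acyclic : ∀ {u v} → E u v → Star E v u → ⊥) where

  vertexAt-injective : ∀ {x y} (p : Star E x y) → Injective _≡_ _≡_ (vertexAt p)
  vertexAt-injective p {i} {j} eq with <-cmp i j
  ... | tri< i<j _ _ = let _ , e , q = arc-between p i<j in ⊥-elim (acyclic e (subst (Star E _) (sym eq) q))
  ... | tri≈ _ i≡j _ = i≡j
  ... | tri> _ _ j<i = let _ , e , q = arc-between p j<i in ⊥-elim (acyclic e (subst (Star E _) eq q))

  length<n : ∀ {x y} (p : Star E x y) → length p <ℕ n
  length<n p = injective⇒≤ (vertexAt-injective p)

  acc-of-bounded-paths : ∀ b {c} → (∀ {d} (p : Star E c d) → length p <ℕ b) → Acc (flip E) c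
  acc-of-bounded-paths zero    bounded = ⊥-elim (n≮0 (bounded ε))
  acc-of-bounded-paths (suc b) bounded = acc λ e → acc-of-bounded-paths b λ p → ≤-pred (bounded (e ◅ p))

  flip-wellFounded : WellFounded (flip E)
  flip-wellFounded _ = acc-of-bounded-paths n length<n

  module _ (E? : Decidable E) where

    star? : Decidable (Star E)
    star? x y = from (flip-wellFounded x)
      where
      from : ∀ {x} → Acc (flip E) x → Dec (Star E x y)
      from {x} (acc rs) with x ≟ y
      ... | yes refl = yes ε
      ... | no x≢y with any? via
        where
        via : ∀ u → Dec (Σ (E x u) λ _ → Star E u y)
        via u with E? x u
        ... | yes e = map′ (e ,_) proj₂ (from (rs e))
        ... | no ¬e = no λ (e , _) → ¬e e
      ...   | yes (_ , e , p) = yes (e ◅ p)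
      ...   | no ¬via         = no λ { ε → x≢y refl ; (e ◅ p) → ¬via (_ , e , p) }

    minimal-below : ∀ {p} {P : Pred (Fin n) p} → U.Decidable P →
                    ∀ {c} → P c → Σ (Fin n) λ m → Minimal P m × Star E c m
    minimal-below {P = P} P? {c} = below (Plus.wellFounded (flip E) flip-wellFounded c)
      where
      below : ∀ {c} → Acc (TransClosure (flip E)) c → P c → Σ (Fin n) λ m → Minimal P m × Star E c m
      below {c} (acc rs) Pc with any? (λ q → P? q ×-dec star? c q ×-dec ¬? (q ≟ c))
      ... | yes (_ , _  , ε     , q≢c) = ⊥-elim (q≢c refl)
      ... | yes (_ , Pq , e ◅ p , _)   = let m , min , q⇝m = below (rs (arc-star-⁺ e p)) Pq
                                          in m , min , (e ◅ p) ◅◅ q⇝m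
      ... | no none = c , (Pc , λ q Pq c⇝q → decidable-stable (q ≟ c) λ q≢c → none (q , Pq , c⇝q , q≢c)) , ε

module _ (G : DAG) where
  open DAG G

  commonAnc? : ∀ U → U.Decidable (CommonAnc G U)
  commonAnc? U c = all? λ u → u ∈? U →-dec star? acyclic E? c u

  ⊆C⇒commonAnc : ∀ {U v} → (∀ u → u ∈ U → C G v u) → CommonAnc G U v
  ⊆C⇒commonAnc U⊆Cv u u∈U = proj₂ (U⊆Cv u u∈U)

  lca-⪯-commonAnc : ∀ {U q c} → LcaIs G U q → CommonAnc G U c → G ⊢ q ⪯ c
  lca-⪯-commonAnc {U} {c = c} (_ , unique) ca =
    let m , lca-m , c⇝m = minimal-below acyclic E? (commonAnc? U) ca
    in subst (G ⊢_⪯ c) (unique m lca-m) c⇝m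

  C-mono : ∀ {v w} → G ⊢ v ⪯ w → ∀ x → C G v x → C G w x
  C-mono w⇝v x (leaf , v⇝x) = leaf , w⇝v ◅◅ v⇝x

  ⊆C-lca : ∀ {U q} → (∀ x → x ∈ U → IsLeaf G x) → LcaIs G U q → ∀ u → u ∈ U → C G q u
  ⊆C-lca leaves ((commonAnc , _) , _) u u∈U = leaves u u∈U , commonAnc u u∈U

  C-lca≐R-𝒞 : ∀ {U q} → (∀ x → x ∈ U → IsLeaf G x) → LcaIs G U q → _≐_ G (C G q) (R-𝒞 G U)
  C-lca≐R-𝒞 leaves lca =
      (λ x x∈Cq → proj₁ x∈Cq , λ v U⊆Cv → C-mono (lca-⪯-commonAnc lca (⊆C⇒commonAnc U⊆Cv)) x x∈Cq)
    , (λ x (_ , in-every-C⊇U) → in-every-C⊇U _ (⊆C-lca leaves lca))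

  C-lca-⁅⁆ : ∀ {x q} → IsLeaf G x → LcaIs G ⁅ x ⁆ q → _≐_ G (C G q) (_≡ x)
  C-lca-⁅⁆ {x} {q} leaf lca@(_ , unique) =
      (λ y (_ , q⇝y) → leaf y (subst (G ⊢ y ⪯_) q≡x q⇝y))
    , (λ { _ refl → ⊆C-lca ⁅x⁆-leaves lca x (x∈⁅x⁆ x) })
    where
    ∈⁅x⁆⇒≡x : ∀ {u} → u ∈ ⁅ x ⁆ → u ≡ x
    ∈⁅x⁆⇒≡x = Equivalence.to x∈⁅y⁆⇔x≡y

    ⁅x⁆-leaves : ∀ u → u ∈ ⁅ x ⁆ → IsLeaf G u
    ⁅x⁆-leaves u u∈ = subst (IsLeaf G) (sym (∈⁅x⁆⇒≡x u∈)) leaf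

    x-isLCA : IsLCA G ⁅ x ⁆ x
    x-isLCA = (λ u u∈ → subst (G ⊢_⪯ x) (sym (∈⁅x⁆⇒≡x u∈)) ε) , λ q′ _ → leaf q′

    q≡x : q ≡ x
    q≡x = sym (unique x x-isLCA)

proposition2 : (G : DAG) (k : ℕ) → k ≥ 1 → (P : KLcaProperty G k) →
    (IsTransitFunction G k (R-G G k P) × IsMonotone G k (R-G G k P)) ×
    (∀ U hU → _≐_ G (R-G G k P U hU) (R-𝒞 G U)) ×
    PreKary G k
proposition2 G k _ P = (transit , monotone) , R-G≐R-𝒞 , preKary
  where
  lca : ∀ U hU → LcaIs G U (proj₁ (P U hU))
  lca U hU = proj₂ (P U hU)

  R-G≐R-𝒞 : ∀ U hU → _≐_ G (R-G G k P U hU) (R-𝒞 G U)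
  R-G≐R-𝒞 U hU = C-lca≐R-𝒞 G (proj₁ hU) (lca U hU)

  transit : IsTransitFunction G k (R-G G k P)
  transit = (λ _ _ _ → proj₁)
          , (λ U hU → ⊆C-lca G (proj₁ hU) (lca U hU))
          , (λ x h → C-lca-⁅⁆ G (proj₁ h x (x∈⁅x⁆ x)) (lca ⁅ x ⁆ h))

  monotone : IsMonotone G k (R-G G k P)
  monotone U hU W hW W⊆RU = C-mono G (lca-⪯-commonAnc G (lca W hW) (⊆C⇒commonAnc G W⊆RU))

  preKary : PreKary G k
  preKary U hU = proj₁ (P U hU) , swap (R-G≐R-𝒞 U hU)
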